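{- Let $Y=(8,\underbrace{4,\dots,4}_{11},\underbrace{0,\dots,0}_{11})^{B_{23}}\subset\mathbb{R}^{23}$ be the set of vectors obtained from $(8,4^{11},0^{11})$ by permuting coordinates and changing signs of coordinates (this is $(4\sqrt{15}\,v_{2,11})^{B_{23}}$). Define $\Upsilon:\mathbb{R}^{23}\to\mathbb{R}^{24}$ by \[ \Upsilon(x_1,\dots,x_{23}) = \Bigl(\tfrac{x_1}{\sqrt2},\tfrac{x_1}{\sqrt2},\tfrac{x_2-x_3}{\sqrt2},\tfrac{x_2+x_3}{\sqrt2},\dots,\tfrac{x_{22}-x_{23}}{\sqrt2},\tfrac{x_{22}+x_{23}}{\sqrt2}\Bigr). \] Then $\Upsilon(Y)$ is contained in a single shell of the shorter Leech lattice $O_{23}$, i.e. in $\{x\in O_{23}:\|x\|^2=m\}$ for some $m$.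
   Context: $v_{2,11}=15^{ -1/2}(2,1^{11},0^{11})\in\mathbb{R}^{23}$ and $B_{23}$ is the group of coordinate permutations and sign changes. Let $G_{24}\subset\{0,1\}^{24}\subset\mathbb{R}^{24}$ be the codewords of the extended binary Golay code (for a fixed coordinate ordering), viewed as real 0/1 vectors, and $\mathbf 1$ the all-ones vector. The Leech lattice is $\Lambda_{24}=\{\tfrac{1}{\sqrt8}(2c+4x): c\in G_{24},\ x\in\mathbb{Z}^{24},\ \sum x_i\equiv0 \pmod 2\}\cup\{\tfrac{1}{\sqrt8}(\mathbf 1+2c+4x): c\in G_{24},\ x\in\mathbb{Z}^{24},\ \sum x_i\equiv0 \pmod 2\}$. Let $v=\tfrac1{\sqrt8}(4,-4,0,\dots,0)\in\Lambda_{24}$ and let $\pi(t)=t-\frac{\langle t,v\rangle}{\|v\|^2}v$ be the orthogonal projection onto $v^\perp$. The shorter Leech lattice is $O_{23}=\{\pi(x): x\in\Lambda_{24},\ \langle x,v\rangle\in2\mathbb{Z}\}\subset v^\perp$. A shell of a lattice is the set of its vectors of a fixed squared norm. -}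

module Defs where

open import Data.Bool using (Bool; true; false; _xor_; _∧_; if_then_else_)
open import Data.Nat using (ℕ; _≡ᵇ_; _≤ᵇ_)
open import Data.Fin using (Fin; zero; suc; toℕ; #_)
open import Data.Fin.Permutation using (Permutation′; _⟨$⟩ʳ_)
open import Data.Vec using (Vec; []; _∷_; lookup)
open import Data.Integer using (ℤ; +_; -_; _+_; _-_; _*_)
open import Data.Integer.Divisibility using (_∣_)
open import Data.Product using (Σ; ∃; _×_)
open import Data.Sum using (_⊎_)
open import Relation.Binary.PropositionalEquality using (_≡_)

-- Every real vector t occurring below has the form t = T / √8 with T an
-- integer vector ("scaled coordinates").  All statements are made about
-- the scaled integer vectors T = √8 · t.  Vectors in ℝ^n are functions
-- Fin n → ℤ (coordinates indexed from 0).

two : ℤ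
two = + 2

Σℤ : ∀ {n} → (Fin n → ℤ) → ℤ
Σℤ {ℕ.zero}  f = + 0
Σℤ {ℕ.suc n} f = f zero + Σℤ {n} (λ i → f (suc i))

dot : ∀ {n} → (Fin n → ℤ) → (Fin n → ℤ) → ℤ
dot x y = Σℤ (λ i → x i * y i)

normSq : ∀ {n} → (Fin n → ℤ) → ℤ
normSq x = dot x x

-- Extended binary Golay code G24 (fixed coordinate ordering):
-- the cyclic [23,12,7] code with generator polynomial
-- 1 + x^2 + x^4 + x^5 + x^6 + x^10 + x^11 (coordinates 0..22),
-- extended by an overall parity bit (coordinate 23).
-- Generator matrix rows: x^i g(x), i = 0..11, plus parity.

golayGen : Vec (Vec Bool 24) 12
golayGen =
  ( true ∷ false ∷ true ∷ false ∷ true ∷ true ∷ true ∷ false ∷ false ∷ false ∷ true ∷ true ∷ false ∷ false ∷ false ∷ false ∷ false ∷ false ∷ false ∷ false ∷ false ∷ false ∷ false ∷ true ∷ [])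
  ∷ (false ∷ true ∷ false ∷ true ∷ false ∷ true ∷ true ∷ true ∷ false ∷ false ∷ false ∷ true ∷ true ∷ false ∷ false ∷ false ∷ false ∷ false ∷ false ∷ false ∷ false ∷ false ∷ false ∷ true ∷ [])
  ∷ (false ∷ false ∷ true ∷ false ∷ true ∷ false ∷ true ∷ true ∷ true ∷ false ∷ false ∷ false ∷ true ∷ true ∷ false ∷ false ∷ false ∷ false ∷ false ∷ false ∷ false ∷ false ∷ false ∷ true ∷ [])
  ∷ (false ∷ false ∷ false ∷ true ∷ false ∷ true ∷ false ∷ true ∷ true ∷ true ∷ false ∷ false ∷ false ∷ true ∷ true ∷ false ∷ false ∷ false ∷ false ∷ false ∷ false ∷ false ∷ false ∷ true ∷ [])
  ∷ (false ∷ false ∷ false ∷ false ∷ true ∷ false ∷ true ∷ false ∷ true ∷ true ∷ true ∷ false ∷ false ∷ false ∷ true ∷ true ∷ false ∷ false ∷ false ∷ false ∷ false ∷ false ∷ false ∷ true ∷ [])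
  ∷ (false ∷ false ∷ false ∷ false ∷ false ∷ true ∷ false ∷ true ∷ false ∷ true ∷ true ∷ true ∷ false ∷ false ∷ false ∷ true ∷ true ∷ false ∷ false ∷ false ∷ false ∷ false ∷ false ∷ true ∷ [])
  ∷ (false ∷ false ∷ false ∷ false ∷ false ∷ false ∷ true ∷ false ∷ true ∷ false ∷ true ∷ true ∷ true ∷ false ∷ false ∷ false ∷ true ∷ true ∷ false ∷ false ∷ false ∷ false ∷ false ∷ true ∷ [])
  ∷ (false ∷ false ∷ false ∷ false ∷ false ∷ false ∷ false ∷ true ∷ false ∷ true ∷ false ∷ true ∷ true ∷ true ∷ false ∷ false ∷ false ∷ true ∷ true ∷ false ∷ false ∷ false ∷ false ∷ true ∷ [])
  ∷ (false ∷ false ∷ false ∷ false ∷ false ∷ false ∷ false ∷ false ∷ true ∷ false ∷ true ∷ false ∷ true ∷ true ∷ true ∷ false ∷ false ∷ false ∷ true ∷ true ∷ false ∷ false ∷ false ∷ true ∷ [])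
  ∷ (false ∷ false ∷ false ∷ false ∷ false ∷ false ∷ false ∷ false ∷ false ∷ true ∷ false ∷ true ∷ false ∷ true ∷ true ∷ true ∷ false ∷ false ∷ false ∷ true ∷ true ∷ false ∷ false ∷ true ∷ [])
  ∷ (false ∷ false ∷ false ∷ false ∷ false ∷ false ∷ false ∷ false ∷ false ∷ false ∷ true ∷ false ∷ true ∷ false ∷ true ∷ true ∷ true ∷ false ∷ false ∷ false ∷ true ∷ true ∷ false ∷ true ∷ [])
  ∷ (false ∷ false ∷ false ∷ false ∷ false ∷ false ∷ false ∷ false ∷ false ∷ false ∷ false ∷ true ∷ false ∷ true ∷ false ∷ true ∷ true ∷ true ∷ false ∷ false ∷ false ∷ true ∷ true ∷ true ∷ [])
  ∷ []

xorSum : ∀ {n} → (Fin n → Bool) → Bool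
xorSum {ℕ.zero}  f = false
xorSum {ℕ.suc n} f = f zero xor xorSum {n} (λ i → f (suc i))

codeword : (Fin 12 → Bool) → Fin 24 → Bool
codeword a j = xorSum (λ i → a i ∧ lookup (lookup golayGen i) j)

InGolay : (Fin 24 → Bool) → Set
InGolay c = Σ (Fin 12 → Bool) λ a → ∀ j → c j ≡ codeword a j

b2z : Bool → ℤ
b2z true  = + 1
b2z false = + 0

-- Leech lattice, in scaled coordinates: X = √8 · x.
-- x ∈ Λ24  iff  X = 2c + 4y  or  X = 1 + 2c + 4y  with c ∈ G24, Σ y even.

InLeechScaled : (Fin 24 → ℤ) → Set
InLeechScaled X =
  Σ (Fin 24 → Bool) λ c → InGolay c ×
  Σ (Fin 24 → ℤ) λ y → (two ∣ Σℤ y) ×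
    ((∀ j → X j ≡ two * b2z (c j) + + 4 * y j)
     ⊎ (∀ j → X j ≡ + 1 + two * b2z (c j) + + 4 * y j))

-- scaled v = √8 · (1/√8)(4,-4,0,...,0)
Vsc : Fin 24 → ℤ
Vsc zero          = + 4
Vsc (suc zero)    = - (+ 4)
Vsc (suc (suc _)) = + 0

-- w ∈ O23 (w given in scaled coordinates W = √8 · w):
-- ∃ x ∈ Λ24 with ⟨x,v⟩ ∈ 2ℤ and π(x) = w.
-- ⟨x,v⟩ = ⟨X,V⟩/8, so ⟨x,v⟩ ∈ 2ℤ ⟺ 16 ∣ ⟨X,V⟩;
-- π(x) = w ⟺ ‖V‖² W = ‖V‖² X − ⟨X,V⟩ V  (‖V‖² = 32).
InO23Scaled : (Fin 24 → ℤ) → Set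
InO23Scaled W =
  Σ (Fin 24 → ℤ) λ X → InLeechScaled X ×
    ((+ 16 ∣ dot X Vsc) ×
     (∀ j → normSq Vsc * W j ≡ normSq Vsc * X j - dot X Vsc * Vsc j))

-- Y = (8, 4^11, 0^11)^{B23} ⊂ ℝ^23 (genuine, unscaled coordinates).

baseY : Fin 23 → ℤ
baseY i = if toℕ i ≡ᵇ 0 then + 8 else (if toℕ i ≤ᵇ 11 then + 4 else + 0)

sgn : Bool → ℤ
sgn true  = - (+ 1)
sgn false = + 1

InY : (Fin 23 → ℤ) → Set
InY y = Σ (Permutation′ 23) λ σ → Σ (Fin 23 → Bool) λ s →
  ∀ i → y i ≡ sgn (s i) * baseY (σ ⟨$⟩ʳ i)

-- √8 · Υ(x) = 2 · (x1, x1, x2 − x3, x2 + x3, …, x22 − x23, x22 + x23)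
-- (paper's 1-based x1..x23 are x (# 0) .. x (# 22) here)
UpsScaled : (Fin 23 → ℤ) → Fin 24 → ℤ
UpsScaled x = lookup
  ( two * x (# 0)
  ∷ two * x (# 0)
  ∷ two * (x (# 1) - x (# 2))
  ∷ two * (x (# 1) + x (# 2))
  ∷ two * (x (# 3) - x (# 4))
  ∷ two * (x (# 3) + x (# 4))
  ∷ two * (x (# 5) - x (# 6))
  ∷ two * (x (# 5) + x (# 6))
  ∷ two * (x (# 7) - x (# 8))
  ∷ two * (x (# 7) + x (# 8))
  ∷ two * (x (# 9) - x (# 10))
  ∷ two * (x (# 9) + x (# 10))
  ∷ two * (x (# 11) - x (# 12))
  ∷ two * (x (# 11) + x (# 12))
  ∷ two * (x (# 13) - x (# 14))
  ∷ two * (x (# 13) + x (# 14))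
  ∷ two * (x (# 15) - x (# 16))
  ∷ two * (x (# 15) + x (# 16))
  ∷ two * (x (# 17) - x (# 18))
  ∷ two * (x (# 17) + x (# 18))
  ∷ two * (x (# 19) - x (# 20))
  ∷ two * (x (# 19) + x (# 20))
  ∷ two * (x (# 21) - x (# 22))
  ∷ two * (x (# 21) + x (# 22))
  ∷ [])

module Submission where

-- Every coordinate of y ∈ Y is divisible by 4, so √8 Υ(y) = 4z with z = 2 Υ(y/4) an
-- integer vector of even coordinate sum: Υ(y) ∈ Λ₂₄ with Golay word 0.  The first two
-- coordinates of Υ(y) agree, so Υ(y) ⊥ v; hence ⟨Υ(y), v⟩ = 0 is even and π fixes Υ(y),
-- i.e. Υ(y) ∈ O₂₃.  As ‖(a−b, a+b)‖² = 2‖(a, b)‖² and ‖(a, a)‖² = 2a², Υ preserves norms,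
-- so ‖Υ(y)‖² = ‖y‖² = 8² + 11·4² = 240 for every signed permutation y of (8, 4¹¹, 0¹¹).

open import Defs
open import Data.Bool using (Bool; true; false)
open import Data.Nat as ℕ using (zero; suc; _≡ᵇ_; _≤ᵇ_)
open import Data.Nat.Divisibility using (_∣0)
open import Data.Integer using (ℤ; +_; _+_; _-_; _*_)
open import Data.Integer.Properties using (*-comm; +-identityˡ; +-inverseʳ; +-*-semiring)
open import Data.Integer.Divisibility.Signed using (divides; quotient; ∣-refl; ∣m⇒∣m*n; ∣n⇒∣m*n; ∣⇒∣ᵤ)
  renaming (_∣_ to _∣ₛ_)
open import Data.Integer.Divisibility using (_∣_)
open import Data.Integer.Tactic.RingSolver using (solve-∀)
open import Data.Fin using (Fin; zero; suc; toℕ)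
open import Data.Fin.Permutation using (Permutation′; _⟨$⟩ʳ_)
open import Data.Vec using (Vec; []; _∷_; lookup; tabulate; map)
open import Data.Vec.Properties using (lookup-map; lookup∘tabulate; tabulate-∘; tabulate-cong)
open import Data.Product using (Σ; _×_; _,_)
open import Data.Sum using (inj₁)
open import Function using (_∘_)
open import Relation.Binary.PropositionalEquality
  using (_≡_; _≗_; refl; sym; trans; cong; cong₂; subst; module ≡-Reasoning)
import Algebra.Properties.Semiring.Sum as SemiringSum

open SemiringSum +-*-semiring using (sum; sum-cong-≗; *-distribˡ-sum; sum-permute)
open ≡-Reasoning

Σℤ≡sum : ∀ {n} (f : Fin n → ℤ) → Σℤ f ≡ sum f
Σℤ≡sum {zero}  f = refl
Σℤ≡sum {suc n} f = cong (λ t → f zero + t) (Σℤ≡sum (f ∘ suc))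

Σℤ-cong : ∀ {n} {f g : Fin n → ℤ} → f ≗ g → Σℤ f ≡ Σℤ g
Σℤ-cong {f = f} {g} f≗g = begin
  Σℤ f  ≡⟨ Σℤ≡sum f ⟩
  sum f ≡⟨ sum-cong-≗ f≗g ⟩
  sum g ≡⟨ Σℤ≡sum g ⟨
  Σℤ g  ∎

Σℤ-*ˡ : ∀ {n} c (f : Fin n → ℤ) → Σℤ (λ i → c * f i) ≡ c * Σℤ f
Σℤ-*ˡ c f = begin
  Σℤ (λ i → c * f i)  ≡⟨ Σℤ≡sum (λ i → c * f i) ⟩
  sum (λ i → c * f i) ≡⟨ *-distribˡ-sum c f ⟨
  c * sum f           ≡⟨ cong (c *_) (Σℤ≡sum f) ⟨
  c * Σℤ f            ∎

Σℤ-permute : ∀ {n} (σ : Permutation′ n) (f : Fin n → ℤ) → Σℤ (f ∘ (σ ⟨$⟩ʳ_)) ≡ Σℤ f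
Σℤ-permute σ f = begin
  Σℤ (f ∘ (σ ⟨$⟩ʳ_))  ≡⟨ Σℤ≡sum (f ∘ (σ ⟨$⟩ʳ_)) ⟩
  sum (f ∘ (σ ⟨$⟩ʳ_)) ≡⟨ sum-permute f σ ⟨
  sum f               ≡⟨ Σℤ≡sum f ⟨
  Σℤ f                ∎

normSq-cong : ∀ {n} {x y : Fin n → ℤ} → x ≗ y → normSq x ≡ normSq y
normSq-cong x≗y = Σℤ-cong (λ i → cong₂ _*_ (x≗y i) (x≗y i))

normSq-*ˡ : ∀ {n} c (x : Fin n → ℤ) → normSq (λ i → c * x i) ≡ (c * c) * normSq x
normSq-*ˡ c x = trans (Σℤ-cong (λ i → square-* c (x i))) (Σℤ-*ˡ (c * c) (λ i → x i * x i))
  where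
  square-* : ∀ c a → c * a * (c * a) ≡ c * c * (a * a)
  square-* = solve-∀

normSq-signedPermute : ∀ {n} (σ : Permutation′ n) (s : Fin n → Bool) (x : Fin n → ℤ) →
                       normSq (λ i → sgn (s i) * x (σ ⟨$⟩ʳ i)) ≡ normSq x
normSq-signedPermute σ s x =
  trans (Σℤ-cong (λ i → sgn-square (s i) (x (σ ⟨$⟩ʳ i)))) (Σℤ-permute σ (λ i → x i * x i))
  where
  sgn-square : ∀ b a → sgn b * a * (sgn b * a) ≡ a * a
  sgn-square true  = solve-∀
  sgn-square false = solve-∀

dot-Vsc : ∀ (X : Fin 24 → ℤ) → dot X Vsc ≡ + 4 * (X zero - X (suc zero))
dot-Vsc X = begin
  X zero * + 4 + (X (suc zero) * Vsc (suc zero) + Σℤ (λ i → X (suc (suc i)) * + 0))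
    ≡⟨ cong (λ t → X zero * + 4 + (X (suc zero) * Vsc (suc zero) + t)) tail-vanishes ⟩
  X zero * + 4 + (X (suc zero) * Vsc (suc zero) + + 0)
    ≡⟨ collect (X zero) (X (suc zero)) ⟩
  + 4 * (X zero - X (suc zero)) ∎
  where
  tail-vanishes : Σℤ (λ i → X (suc (suc i)) * + 0) ≡ + 0
  tail-vanishes =
    trans (Σℤ-cong (λ i → *-comm (X (suc (suc i))) (+ 0))) (Σℤ-*ˡ (+ 0) (λ i → X (suc (suc i))))
  collect : ∀ a b → a * + 4 + (b * Vsc (suc zero) + + 0) ≡ + 4 * (a - b)
  collect = solve-∀

inLeech-fourMultiple : ∀ (z X : Fin 24 → ℤ) → two ∣ Σℤ z → (∀ j → X j ≡ + 4 * z j) → InLeechScaled X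
inLeech-fourMultiple z X even X≡4z =
  (λ _ → false) , ((λ _ → false) , λ _ → refl) , z , even ,
  inj₁ (λ j → trans (X≡4z j) (sym (+-identityˡ _)))

inO23-orthogonal : ∀ (X : Fin 24 → ℤ) → InLeechScaled X → dot X Vsc ≡ + 0 → InO23Scaled X
inO23-orthogonal X X∈Λ X⊥v = X , X∈Λ , subst (+ 16 ∣_) (sym X⊥v) (16 ∣0) , projection-fixes
  where
  minus-zero : ∀ a b → a ≡ a - + 0 * b
  minus-zero = solve-∀
  projection-fixes : ∀ j → normSq Vsc * X j ≡ normSq Vsc * X j - dot X Vsc * Vsc j
  projection-fixes j =
    trans (minus-zero (normSq Vsc * X j) (Vsc j)) (cong (λ t → normSq Vsc * X j - t * Vsc j) (sym X⊥v))

-- upsilon n is √2 Υ on ℤ^(2n+1), so UpsScaled is 2 · upsilon 11.  Lengths are written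
-- n ℕ.* 2 because suc n ℕ.* 2 reduces to suc (suc (n ℕ.* 2)).
pairTransform : ∀ n → Vec ℤ (n ℕ.* 2) → Vec ℤ (n ℕ.* 2)
pairTransform zero    []           = []
pairTransform (suc n) (a ∷ b ∷ xs) = a - b ∷ a + b ∷ pairTransform n xs

upsilon : ∀ n → Vec ℤ (suc (n ℕ.* 2)) → Vec ℤ (suc (suc (n ℕ.* 2)))
upsilon n (a ∷ xs) = a ∷ a ∷ pairTransform n xs

normSq-pairTransform : ∀ n (xs : Vec ℤ (n ℕ.* 2)) →
                       normSq (lookup (pairTransform n xs)) ≡ two * normSq (lookup xs)
normSq-pairTransform zero    []           = refl
normSq-pairTransform (suc n) (a ∷ b ∷ xs) =
  trans (cong (λ t → (a - b) * (a - b) + ((a + b) * (a + b) + t)) (normSq-pairTransform n xs))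
        (parallelogram a b (normSq (lookup xs)))
  where
  parallelogram : ∀ a b t → (a - b) * (a - b) + ((a + b) * (a + b) + two * t) ≡ two * (a * a + (b * b + t))
  parallelogram = solve-∀

normSq-upsilon : ∀ n (xs : Vec ℤ (suc (n ℕ.* 2))) →
                 normSq (lookup (upsilon n xs)) ≡ two * normSq (lookup xs)
normSq-upsilon n (a ∷ xs) =
  trans (cong (λ t → a * a + (a * a + t)) (normSq-pairTransform n xs)) (doubling a (normSq (lookup xs)))
  where
  doubling : ∀ a t → a * a + (a * a + two * t) ≡ two * (a * a + t)
  doubling = solve-∀

pairTransform-*ˡ : ∀ n c (xs : Vec ℤ (n ℕ.* 2)) →
                   pairTransform n (map (c *_) xs) ≡ map (c *_) (pairTransform n xs)
pairTransform-*ˡ zero    c []           = refl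
pairTransform-*ˡ (suc n) c (a ∷ b ∷ xs) =
  cong₂ _∷_ (distrib-- c a b) (cong₂ _∷_ (distrib-+ c a b) (pairTransform-*ˡ n c xs))
  where
  distrib-- : ∀ c a b → c * a - c * b ≡ c * (a - b)
  distrib-- = solve-∀
  distrib-+ : ∀ c a b → c * a + c * b ≡ c * (a + b)
  distrib-+ = solve-∀

upsilon-*ˡ : ∀ n c (xs : Vec ℤ (suc (n ℕ.* 2))) →
             upsilon n (map (c *_) xs) ≡ map (c *_) (upsilon n xs)
upsilon-*ˡ n c (a ∷ xs) = cong (λ ys → c * a ∷ c * a ∷ ys) (pairTransform-*ˡ n c xs)

UpsScaled-upsilon : ∀ x j → UpsScaled x j ≡ two * lookup (upsilon 11 (tabulate x)) j
UpsScaled-upsilon x j = trans unfold (lookup-map j (two *_) (upsilon 11 (tabulate x)))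
  where
  -- both vectors normalise to the same 24-entry literal
  unfold : UpsScaled x j ≡ lookup (map (two *_) (upsilon 11 (tabulate x))) j
  unfold = refl

UpsScaled-cong : ∀ {x y} → x ≗ y → UpsScaled x ≗ UpsScaled y
UpsScaled-cong x≗y j = cong (λ v → UpsScaled (lookup v) j) (tabulate-cong x≗y)

UpsScaled-*ˡ : ∀ c x j → UpsScaled (λ i → c * x i) j ≡ c * UpsScaled x j
UpsScaled-*ˡ c x j = begin
  UpsScaled (λ i → c * x i) j
    ≡⟨ UpsScaled-upsilon (λ i → c * x i) j ⟩
  two * lookup (upsilon 11 (tabulate (λ i → c * x i))) j
    ≡⟨ cong (λ v → two * lookup (upsilon 11 v) j) (tabulate-∘ (c *_) x) ⟩
  two * lookup (upsilon 11 (map (c *_) xs)) j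
    ≡⟨ cong (λ v → two * lookup v j) (upsilon-*ˡ 11 c xs) ⟩
  two * lookup (map (c *_) (upsilon 11 xs)) j
    ≡⟨ cong (two *_) (lookup-map j (c *_) (upsilon 11 xs)) ⟩
  two * (c * lookup (upsilon 11 xs) j)
    ≡⟨ swap c (lookup (upsilon 11 xs) j) ⟩
  c * (two * lookup (upsilon 11 xs) j)
    ≡⟨ cong (c *_) (UpsScaled-upsilon x j) ⟨
  c * UpsScaled x j
    ∎
  where
  xs : Vec ℤ 23
  xs = tabulate x
  swap : ∀ c u → two * (c * u) ≡ c * (two * u)
  swap = solve-∀

normSq-UpsScaled : ∀ x → normSq (UpsScaled x) ≡ + 8 * normSq x
normSq-UpsScaled x = begin
  normSq (UpsScaled x)                          ≡⟨ normSq-cong (UpsScaled-upsilon x) ⟩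
  normSq (λ j → two * lookup (upsilon 11 xs) j) ≡⟨ normSq-*ˡ two (lookup (upsilon 11 xs)) ⟩
  + 4 * normSq (lookup (upsilon 11 xs))         ≡⟨ cong (+ 4 *_) (normSq-upsilon 11 xs) ⟩
  + 4 * (two * normSq (lookup xs))              ≡⟨ cong (λ t → + 4 * (two * t)) xs-norm ⟩
  + 4 * (two * normSq x)                        ≡⟨ reassociate (normSq x) ⟩
  + 8 * normSq x                                ∎
  where
  xs : Vec ℤ 23
  xs = tabulate x
  xs-norm : normSq (lookup xs) ≡ normSq x
  xs-norm = normSq-cong (lookup∘tabulate x)
  reassociate : ∀ t → + 4 * (two * t) ≡ + 8 * t
  reassociate = solve-∀

two∣Σℤ-UpsScaled : ∀ x → two ∣ Σℤ (UpsScaled x)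
two∣Σℤ-UpsScaled x = ∣⇒∣ᵤ (subst (two ∣ₛ_) (sym Σ≡2Σ) (∣m⇒∣m*n _ ∣-refl))
  where
  Σ≡2Σ : Σℤ (UpsScaled x) ≡ two * Σℤ (lookup (upsilon 11 (tabulate x)))
  Σ≡2Σ = trans (Σℤ-cong (UpsScaled-upsilon x)) (Σℤ-*ˡ two (lookup (upsilon 11 (tabulate x))))

UpsScaled-⊥-Vsc : ∀ x → dot (UpsScaled x) Vsc ≡ + 0
UpsScaled-⊥-Vsc x = trans (dot-Vsc (UpsScaled x)) (cong (+ 4 *_) (+-inverseʳ (UpsScaled x zero)))

UpsScaled-inLeech : ∀ x → (∀ i → + 4 ∣ₛ x i) → InLeechScaled (UpsScaled x)
UpsScaled-inLeech x 4∣x = inLeech-fourMultiple (UpsScaled k) (UpsScaled x) (two∣Σℤ-UpsScaled k) x≡4k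
  where
  k : Fin 23 → ℤ
  k i = quotient (4∣x i)
  x≡4k : ∀ j → UpsScaled x j ≡ + 4 * UpsScaled k j
  x≡4k j = trans (UpsScaled-cong (λ i → trans (_∣ₛ_.equality (4∣x i)) (*-comm (k i) (+ 4))) j)
                 (UpsScaled-*ˡ (+ 4) k j)

4∣baseY : ∀ i → + 4 ∣ₛ baseY i
4∣baseY i with toℕ i ≡ᵇ 0 | toℕ i ≤ᵇ 11
... | true  | _     = divides (+ 2) refl
... | false | true  = divides (+ 1) refl
... | false | false = divides (+ 0) refl

4∣Y : ∀ {y} → InY y → ∀ i → + 4 ∣ₛ y i
4∣Y (σ , s , y≡) i = subst (+ 4 ∣ₛ_) (sym (y≡ i)) (∣n⇒∣m*n (sgn (s i)) (4∣baseY (σ ⟨$⟩ʳ i)))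

normSq-Y : ∀ {y} → InY y → normSq y ≡ + 240
normSq-Y (σ , s , y≡) = trans (normSq-cong y≡) (normSq-signedPermute σ s baseY)

theorem7p5 : Σ ℤ λ M → (y : Fin 23 → ℤ) → InY y → InO23Scaled (UpsScaled y) × (normSq (UpsScaled y) ≡ M)
theorem7p5 = + 1920 , λ y y∈Y →
  inO23-orthogonal (UpsScaled y) (UpsScaled-inLeech y (4∣Y y∈Y)) (UpsScaled-⊥-Vsc y) ,
  trans (normSq-UpsScaled y) (cong (+ 8 *_) (normSq-Y y∈Y))
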